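{- Let $\mathcal{N}$ be a finite ground set, $f\colon 2^{\mathcal{N}} \to \mathbb{R}_{\geq 0}$ a non-negative monotone submodular function and $c\colon \mathcal{N} \to (0, 1]$; let $OPT$ be a set maximizing $f$ among all $S \subseteq \mathcal{N}$ with $c(S) \leq 1$. If $\tilde{S}$ is the final set $S$ constructed by Algorithm EST, then $f(\tilde{S}) \leq 4 \cdot f(OPT)$.
   Context: $c(S) = \sum_{u \in S} c(u)$ and $f(u \mid S) = f(S \cup \{u\}) - f(S)$. Algorithm EST: start with $S = \emptyset$; process the elements $u$ of $\mathcal{N}$ one by one in a fixed order, adding $u$ to $S$ whenever $f(u \mid S)/c(u) \geq f(S)$; output $f(S)/4$.
   Formalization: The function f takes values in the non-negative rationals and the costs c in the rationals of (0, 1], rather than in the reals. -}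

module Defs where

open import Data.Nat using (ℕ)
open import Data.Bool using (true; false)
open import Data.Fin using (Fin)
open import Data.Fin.Subset using (Subset; _∪_; _∩_; _⊆_; ⁅_⁆)
open import Data.Fin.Subset.Properties using (_∈?_)
open import Data.Fin.Permutation using (Permutation′; _⟨$⟩ʳ_)
open import Data.List using (List; foldl; map; allFin)
open import Data.Vec using (Vec; []; _∷_)
open import Data.Rational using (ℚ; 0ℚ; _+_; _-_; _÷_; _≤_; Positive)
open import Data.Rational.Properties using (_≤?_; pos⇒nonZero)
open import Relation.Nullary using (yes; no)

cost : ∀ {n} → (Fin n → ℚ) → Subset n → ℚ
cost {n} c S = go (allFin n)
  where
  go : List (Fin n) → ℚ
  go Data.List.[] = 0ℚ
  go (u Data.List.∷ us) with u ∈? S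
  ... | yes _ = c u + go us
  ... | no  _ = go us

marginal : ∀ {n} → (Subset n → ℚ) → Fin n → Subset n → ℚ
marginal f u S = f (S ∪ ⁅ u ⁆) - f S

NonNegative : ∀ {n} → (Subset n → ℚ) → Set
NonNegative f = ∀ S → 0ℚ ≤ f S

Monotone : ∀ {n} → (Subset n → ℚ) → Set
Monotone f = ∀ S T → S ⊆ T → f S ≤ f T

Submodular : ∀ {n} → (Subset n → ℚ) → Set
Submodular f = ∀ S T → f (S ∪ T) + f (S ∩ T) ≤ f S + f T

estStep : ∀ {n} (f : Subset n → ℚ) (c : Fin n → ℚ) →
          (∀ u → Positive (c u)) → Subset n → Fin n → Subset n
estStep f c cpos S u with f S ≤? ((marginal f u S ÷ c u) {{pos⇒nonZero (c u) {{cpos u}}}})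
... | yes _ = S ∪ ⁅ u ⁆
... | no  _ = S

estSet : ∀ {n} (f : Subset n → ℚ) (c : Fin n → ℚ) →
         (∀ u → Positive (c u)) → Permutation′ n → Subset n
estSet {n} f c cpos σ =
  foldl (estStep f c cpos) (Data.Fin.Subset.⊥) (map (σ ⟨$⟩ʳ_) (allFin n))

{-# OPTIONS --safe #-}
-- An element u accepted by EST at the current set S satisfies
-- f(S ∪ {u}) ≥ (1 + c(u)) f(S).  If the accepted elements cost at most 1 in
-- total, f(S̃) ≤ f(OPT).  Otherwise let P be the shortest block of most recently
-- accepted elements with c(P) > 1, and R the earlier ones.  P without its
-- oldest element u is affordable, and so is {u}, so subadditivity gives
-- f(P) ≤ 2 f(OPT); the multiplicative growth gives f(S̃) ≥ (1 + c(P)) f(R) ≥ 2 f(R).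
-- With f(S̃) ≤ f(R) + f(P) this yields f(R) ≤ 2 f(OPT), hence f(S̃) ≤ 4 f(OPT).
module Submission where

open import Defs
open import Data.Nat using (ℕ; zero; suc)
open import Data.Bool using (true; false; _∨_; if_then_else_)
open import Data.Fin using (Fin; zero; suc)
open import Data.Fin.Subset using (Subset; _∪_; _∩_; _⊆_; ⁅_⁆; ⊥)
open import Data.Fin.Subset.Properties using (_∈?_; p⊆p∪q; ∪-assoc; ∪-identityʳ)
open import Data.Fin.Permutation using (Permutation′; _⟨$⟩ʳ_)
open import Data.List using (List; []; _∷_; _++_; _∷ʳ_; map; foldl; allFin; tabulate)
open import Data.List.Properties using (map-tabulate)
open import Data.Vec using ([]; _∷_)
open import Data.Product using (∃; ∃₂; _×_; _,_)
open import Data.Sum using (_⊎_; inj₁; inj₂)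
open import Data.Rational
  using (ℚ; 0ℚ; 1ℚ; _+_; _-_; -_; _*_; _÷_; 1/_; _≤_; _<_; Positive; nonNegative)
open import Data.Rational.Properties
open import Data.Rational.Solver using (module +-*-Solver)
open import Function using (_∘_; id)
open import Relation.Binary.PropositionalEquality
  using (_≡_; refl; sym; trans; cong; subst; module ≡-Reasoning)
open import Relation.Nullary using (yes; no)

open +-*-Solver

+-cancelˡ-≤ : ∀ r {p q} → r + p ≤ r + q → p ≤ q
+-cancelˡ-≤ r {p} {q} r+p≤r+q = begin
  p              ≡⟨ sym (neg-cancel p) ⟩
  - r + (r + p)  ≤⟨ +-monoʳ-≤ (- r) r+p≤r+q ⟩
  - r + (r + q)  ≡⟨ neg-cancel q ⟩
  q              ∎
  where
  open ≤-Reasoning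
  neg-cancel : ∀ x → - r + (r + x) ≡ x
  neg-cancel = solve 2 (λ r x → :- r :+ (r :+ x) := x) refl r

p≤p+q : ∀ {p q} → 0ℚ ≤ q → p ≤ p + q
p≤p+q {p} 0≤q = ≤-trans (≤-reflexive (sym (+-identityʳ p))) (+-monoʳ-≤ p 0≤q)

r+[q-r]≡q : ∀ q r → r + (q - r) ≡ q
r+[q-r]≡q = solve 2 (λ q r → r :+ (q :- r) := q) refl

p≤q-r⇒r+p≤q : ∀ {p q r} → p ≤ q - r → r + p ≤ q
p≤q-r⇒r+p≤q {p} {q} {r} p≤q-r = ≤-trans (+-monoʳ-≤ r p≤q-r) (≤-reflexive (r+[q-r]≡q q r))

q-r<p⇒q<r+p : ∀ {p q r} → q - r < p → q < r + p
q-r<p⇒q<r+p {p} {q} {r} q-r<p = ≤-<-trans (≤-reflexive (sym (r+[q-r]≡q q r))) (+-monoʳ-< r q-r<p)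

p≤q⇒0≤q-p : ∀ {p q} → p ≤ q → 0ℚ ≤ q - p
p≤q⇒0≤q-p {p} {q} p≤q = ≤-trans (≤-reflexive (sym (+-inverseʳ p))) (+-monoˡ-≤ (- p) p≤q)

p≤q÷r⇒r*p≤q : ∀ {p q} r .{{_ : Positive r}} → p ≤ (q ÷ r) {{pos⇒nonZero r}} → r * p ≤ q
p≤q÷r⇒r*p≤q {p} {q} r p≤q÷r =
  ≤-trans (*-monoˡ-≤-nonNeg r {{pos⇒nonNeg r}} p≤q÷r) (≤-reflexive r*[q÷r]≡q)
  where
  instance _ = pos⇒nonZero r
  r*[q÷r]≡q : r * (q ÷ r) ≡ q
  r*[q÷r]≡q = trans (solve 3 (λ r q s → r :* (q :* s) := q :* (r :* s)) refl r q (1/ r))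
                    (trans (cong (q *_) (*-inverseʳ r)) (*-identityʳ q))

p+p≤q≤p+r⇒q≤r+r : ∀ {p q r} → p + p ≤ q → q ≤ p + r → q ≤ r + r
p+p≤q≤p+r⇒q≤r+r {p} {q} {r} p+p≤q q≤p+r =
  ≤-trans q≤p+r (+-monoˡ-≤ r (+-cancelˡ-≤ p (≤-trans p+p≤q q≤p+r)))

module _ {a} {A : Set a} (w : A → ℚ) where

  total : List A → ℚ
  total []       = 0ℚ
  total (x ∷ xs) = w x + total xs

  split-at-budget : ∀ {b} → 0ℚ ≤ b → ∀ xs →
                    total xs ≤ b ⊎
                    ∃₂ λ T u → ∃ λ R → xs ≡ (T ∷ʳ u) ++ R × total T ≤ b × b < total (T ∷ʳ u)
  split-at-budget 0≤b [] = inj₁ 0≤b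
  split-at-budget {b} 0≤b (x ∷ xs) with w x ≤? b
  ... | no wx≰b =
        inj₂ ([] , x , xs , refl , 0≤b , <-≤-trans (≰⇒> wx≰b) (≤-reflexive (sym (+-identityʳ (w x)))))
  ... | yes wx≤b with split-at-budget (p≤q⇒0≤q-p wx≤b) xs
  ...   | inj₁ xs≤b-wx = inj₁ (p≤q-r⇒r+p≤q xs≤b-wx)
  ...   | inj₂ (T , u , R , refl , T≤b-wx , b-wx<Tu) =
          inj₂ (x ∷ T , u , R , refl , p≤q-r⇒r+p≤q T≤b-wx , q-r<p⇒q<r+p b-wx<Tu)

-- Accepted elements are listed newest first, so that setOf (u ∷ us) is literally
-- the set estStep produces when it accepts u after us.
setOf : ∀ {n} → List (Fin n) → Subset n
setOf []       = ⊥
setOf (u ∷ us) = setOf us ∪ ⁅ u ⁆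

setOf-++ : ∀ {n} (xs ys : List (Fin n)) → setOf (xs ++ ys) ≡ setOf ys ∪ setOf xs
setOf-++ []       ys = sym (∪-identityʳ (setOf ys))
setOf-++ (x ∷ xs) ys = trans (cong (_∪ ⁅ x ⁆) (setOf-++ xs ys)) (∪-assoc (setOf ys) (setOf xs) ⁅ x ⁆)

module _ {n} (c : Fin n → ℚ) (S : Subset n) where

  costOver : List (Fin n) → ℚ
  costOver []       = 0ℚ
  costOver (u ∷ us) with u ∈? S
  ... | yes _ = c u + costOver us
  ... | no  _ = costOver us

cost′ : ∀ {n} → (Fin n → ℚ) → Subset n → ℚ
cost′ c []      = 0ℚ
cost′ c (b ∷ S) = (if b then c zero else 0ℚ) + cost′ (c ∘ suc) S

cost≡costOver : ∀ {n} (c : Fin n → ℚ) S → cost c S ≡ costOver c S (allFin n)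
cost≡costOver {n} c S = trans unfold (go≡costOver (allFin n))
  where
  -- cost sums with a local helper of Defs that cannot be named; unification
  -- solves the metavariable go to it.
  go : List (Fin n) → ℚ
  go = _
  unfold : cost c S ≡ go (allFin n)
  unfold with allFin n
  ... | _ = refl
  go≡costOver : ∀ xs → go xs ≡ costOver c S xs
  go≡costOver []       = refl
  go≡costOver (u ∷ us) with u ∈? S
  ... | yes _ = cong (c u +_) (go≡costOver us)
  ... | no  _ = go≡costOver us

costOver-map-suc : ∀ {n} (c : Fin (suc n) → ℚ) b S xs →
                   costOver c (b ∷ S) (map suc xs) ≡ costOver (c ∘ suc) S xs
costOver-map-suc c b S []       = refl
costOver-map-suc c b S (x ∷ xs) with x ∈? S
... | yes _ = cong (c (suc x) +_) (costOver-map-suc c b S xs)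
... | no  _ = costOver-map-suc c b S xs

costOver-tabulate-suc : ∀ {n} (c : Fin (suc n) → ℚ) b S →
                        costOver c (b ∷ S) (tabulate suc) ≡ cost′ (c ∘ suc) S

costOver-allFin : ∀ {n} (c : Fin n → ℚ) S → costOver c S (allFin n) ≡ cost′ c S
costOver-allFin {zero}  c []      = refl
costOver-allFin {suc n} c (true  ∷ S) = cong (c zero +_) (costOver-tabulate-suc c true S)
costOver-allFin {suc n} c (false ∷ S) = trans (costOver-tabulate-suc c false S) (sym (+-identityˡ _))

costOver-tabulate-suc {n} c b S = begin
  costOver c (b ∷ S) (tabulate suc)         ≡⟨ cong (costOver c (b ∷ S)) (sym (map-tabulate id suc)) ⟩
  costOver c (b ∷ S) (map suc (allFin n))   ≡⟨ costOver-map-suc c b S (allFin n) ⟩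
  costOver (c ∘ suc) S (allFin n)           ≡⟨ costOver-allFin (c ∘ suc) S ⟩
  cost′ (c ∘ suc) S                         ∎
  where open ≡-Reasoning

cost≡cost′ : ∀ {n} (c : Fin n → ℚ) S → cost c S ≡ cost′ c S
cost≡cost′ c S = trans (cost≡costOver c S) (costOver-allFin c S)

cost′-⊥ : ∀ {n} (c : Fin n → ℚ) → cost′ c ⊥ ≡ 0ℚ
cost′-⊥ {zero}  c = refl
cost′-⊥ {suc n} c = trans (+-identityˡ _) (cost′-⊥ (c ∘ suc))

cost′-⁅⁆ : ∀ {n} (c : Fin n → ℚ) u → cost′ c ⁅ u ⁆ ≡ c u
cost′-⁅⁆ {suc n} c zero    = trans (cong (c zero +_) (cost′-⊥ (c ∘ suc))) (+-identityʳ _)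
cost′-⁅⁆ {suc n} c (suc u) = trans (+-identityˡ _) (cost′-⁅⁆ (c ∘ suc) u)

cost′-∪ : ∀ {n} (c : Fin n → ℚ) → (∀ u → 0ℚ ≤ c u) →
          ∀ S T → cost′ c (S ∪ T) ≤ cost′ c S + cost′ c T
cost′-∪ c c≥0 []      []      = ≤-reflexive (sym (+-identityˡ 0ℚ))
cost′-∪ c c≥0 (a ∷ S) (b ∷ T) = begin
  [ a ∨ b ] + cost′ c′ (S ∪ T)                 ≤⟨ +-mono-≤ (head-∨ a b) (cost′-∪ c′ (c≥0 ∘ suc) S T) ⟩
  ([ a ] + [ b ]) + (cost′ c′ S + cost′ c′ T)  ≡⟨ interchange [ a ] [ b ] (cost′ c′ S) (cost′ c′ T) ⟩
  ([ a ] + cost′ c′ S) + ([ b ] + cost′ c′ T)  ∎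
  where
  open ≤-Reasoning
  interchange : ∀ x y s t → (x + y) + (s + t) ≡ (x + s) + (y + t)
  interchange = solve 4 (λ x y s t → (x :+ y) :+ (s :+ t) := (x :+ s) :+ (y :+ t)) refl
  c′ = c ∘ suc
  [_] : _ → ℚ
  [ x ] = if x then c zero else 0ℚ
  head-∨ : ∀ x y → [ x ∨ y ] ≤ [ x ] + [ y ]
  head-∨ true  true  = ≤-trans (≤-reflexive (sym (+-identityʳ (c zero)))) (+-monoʳ-≤ (c zero) (c≥0 zero))
  head-∨ true  false = ≤-reflexive (sym (+-identityʳ (c zero)))
  head-∨ false y     = ≤-reflexive (sym (+-identityˡ [ y ]))

cost-setOf≤total : ∀ {n} (c : Fin n → ℚ) → (∀ u → 0ℚ ≤ c u) →
                   ∀ us → cost c (setOf us) ≤ total c us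
cost-setOf≤total c c≥0 us = subst (_≤ total c us) (sym (cost≡cost′ c (setOf us))) (go us)
  where
  open ≤-Reasoning
  go : ∀ us → cost′ c (setOf us) ≤ total c us
  go []       = ≤-reflexive (cost′-⊥ c)
  go (u ∷ us) = begin
    cost′ c (setOf us ∪ ⁅ u ⁆)          ≤⟨ cost′-∪ c c≥0 (setOf us) ⁅ u ⁆ ⟩
    cost′ c (setOf us) + cost′ c ⁅ u ⁆  ≤⟨ +-mono-≤ (go us) (≤-reflexive (cost′-⁅⁆ c u)) ⟩
    total c us + c u                    ≡⟨ +-comm (total c us) (c u) ⟩
    c u + total c us                    ∎

submodular⇒subadditive : ∀ {n} {f : Subset n → ℚ} → NonNegative f → Submodular f →
                         ∀ S T → f (S ∪ T) ≤ f S + f T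
submodular⇒subadditive {f = f} f≥0 f-sub S T = begin
  f (S ∪ T)              ≤⟨ p≤p+q (f≥0 (S ∩ T)) ⟩
  f (S ∪ T) + f (S ∩ T)  ≤⟨ f-sub S T ⟩
  f S + f T              ∎
  where open ≤-Reasoning

module _ {n} (f : Subset n → ℚ) (c : Fin n → ℚ) where

  data Greedy : List (Fin n) → Set where
    []  : Greedy []
    _∷_ : ∀ {u us} → c u * f (setOf us) ≤ marginal f u (setOf us) → Greedy us → Greedy (u ∷ us)

  greedy-growth : Monotone f → (∀ u → 0ℚ ≤ c u) → ∀ P {R} → Greedy (P ++ R) →
                  f (setOf R) + total c P * f (setOf R) ≤ f (setOf (P ++ R))
  greedy-growth _ _ [] {R} _ = ≤-reflexive (solve 1 (λ r → r :+ con 0ℚ :* r := r) refl (f (setOf R)))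
  greedy-growth f-mono c≥0 (u ∷ P) {R} (accepted ∷ g) = begin
    r + (c u + total c P) * r      ≡⟨ regroup r (c u) (total c P) ⟩
    (r + total c P * r) + c u * r  ≤⟨ +-mono-≤ (greedy-growth f-mono c≥0 P g) cu*r≤cu*fX ⟩
    f X + c u * f X                ≤⟨ p≤q-r⇒r+p≤q accepted ⟩
    f (X ∪ ⁅ u ⁆)                  ∎
    where
    open ≤-Reasoning
    regroup : ∀ r x s → r + (x + s) * r ≡ (r + s * r) + x * r
    regroup = solve 3 (λ r x s → r :+ (x :+ s) :* r := (r :+ s :* r) :+ x :* r) refl
    r = f (setOf R)
    X = setOf (P ++ R)
    r≤fX : r ≤ f X
    r≤fX = f-mono (setOf R) X (subst (setOf R ⊆_) (sym (setOf-++ P R)) (p⊆p∪q (setOf P)))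
    cu*r≤cu*fX : c u * r ≤ c u * f X
    cu*r≤cu*fX = *-monoˡ-≤-nonNeg (c u) {{nonNegative (c≥0 u)}} r≤fX

estRun-greedy : ∀ {n} (f : Subset n → ℚ) (c : Fin n → ℚ) (cpos : ∀ u → Positive (c u)) xs {us} →
                Greedy f c us →
                ∃ λ vs → Greedy f c vs × setOf vs ≡ foldl (estStep f c cpos) (setOf us) xs
estRun-greedy f c cpos []       g = _ , g , refl
estRun-greedy f c cpos (x ∷ xs) {us} g
  with f (setOf us) ≤? ((marginal f x (setOf us) ÷ c x) {{pos⇒nonZero (c x) {{cpos x}}}})
... | yes accepted = estRun-greedy f c cpos xs (p≤q÷r⇒r*p≤q (c x) {{cpos x}} accepted ∷ g)
... | no  _        = estRun-greedy f c cpos xs g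

module _ {n} {f : Subset n → ℚ} {c : Fin n → ℚ}
         (f≥0 : NonNegative f) (f-mono : Monotone f) (f-sub : Submodular f)
         (c≥0 : ∀ u → 0ℚ ≤ c u) (c≤1 : ∀ u → c u ≤ 1ℚ)
         (OPT : Subset n) (OPT-optimal : ∀ S → cost c S ≤ 1ℚ → f S ≤ f OPT) where

  private
    O = f OPT

  affordable⇒≤OPT : ∀ us → total c us ≤ 1ℚ → f (setOf us) ≤ O
  affordable⇒≤OPT us us≤1 = OPT-optimal (setOf us) (≤-trans (cost-setOf≤total c c≥0 us) us≤1)

  greedy-≤-4OPT : ∀ {us} → Greedy f c us → f (setOf us) ≤ (O + O) + (O + O)
  greedy-≤-4OPT {us} g with split-at-budget c (<⇒≤ (positive⁻¹ 1ℚ)) us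
  ... | inj₁ us≤1 =
        ≤-trans (affordable⇒≤OPT us us≤1) (≤-trans (p≤p+q O≥0) (p≤p+q (+-mono-≤ O≥0 O≥0)))
    where
    O≥0 : 0ℚ ≤ O
    O≥0 = f≥0 OPT
  ... | inj₂ (T , u , R , refl , T≤1 , 1<Tu) = p+p≤q≤p+r⇒q≤r+r {r} {r = O + O} 2r≤F F≤r+2O
    where
    open ≤-Reasoning
    P = T ∷ʳ u
    r = f (setOf R)
    2r≤F : r + r ≤ f (setOf (P ++ R))
    2r≤F = begin
      r + r              ≡⟨ cong (r +_) (sym (*-identityˡ r)) ⟩
      r + 1ℚ * r         ≤⟨ +-monoʳ-≤ r (*-monoʳ-≤-nonNeg r {{nonNegative (f≥0 (setOf R))}} (<⇒≤ 1<Tu)) ⟩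
      r + total c P * r  ≤⟨ greedy-growth f c f-mono c≥0 P g ⟩
      f (setOf (P ++ R)) ∎
    P≤2O : f (setOf P) ≤ O + O
    P≤2O = begin
      f (setOf (T ++ u ∷ []))            ≡⟨ cong f (setOf-++ T (u ∷ [])) ⟩
      f (setOf (u ∷ []) ∪ setOf T)       ≤⟨ submodular⇒subadditive f≥0 f-sub _ _ ⟩
      f (setOf (u ∷ [])) + f (setOf T)   ≤⟨ +-mono-≤ (affordable⇒≤OPT (u ∷ []) u≤1) (affordable⇒≤OPT T T≤1) ⟩
      O + O                              ∎
      where
      u≤1 : total c (u ∷ []) ≤ 1ℚ
      u≤1 = ≤-trans (≤-reflexive (+-identityʳ (c u))) (c≤1 u)
    F≤r+2O : f (setOf (P ++ R)) ≤ r + (O + O)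
    F≤r+2O = begin
      f (setOf (P ++ R))      ≡⟨ cong f (setOf-++ P R) ⟩
      f (setOf R ∪ setOf P)   ≤⟨ submodular⇒subadditive f≥0 f-sub _ _ ⟩
      r + f (setOf P)         ≤⟨ +-monoʳ-≤ r P≤2O ⟩
      r + (O + O)             ∎

corollary1 : (n : ℕ) (f : Subset n → ℚ) (c : Fin n → ℚ)
    → NonNegative f → Monotone f → Submodular f
    → (cpos : ∀ u → Positive (c u)) → (∀ u → c u ≤ 1ℚ)
    → (σ : Permutation′ n)
    → (OPT : Subset n) → cost c OPT ≤ 1ℚ
    → (∀ S → cost c S ≤ 1ℚ → f S ≤ f OPT)
    → f (estSet f c cpos σ) ≤ (1ℚ + 1ℚ + 1ℚ + 1ℚ) * f OPT
corollary1 n f c f≥0 f-mono f-sub cpos c≤1 σ OPT _ OPT-optimal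
  with estRun-greedy f c cpos (map (σ ⟨$⟩ʳ_) (allFin n)) []
... | us , greedy , us≡S̃ = begin
  f (estSet f c cpos σ)          ≡⟨ cong f (sym us≡S̃) ⟩
  f (setOf us)                   ≤⟨ greedy-≤-4OPT f≥0 f-mono f-sub c≥0 c≤1 OPT OPT-optimal greedy ⟩
  (O + O) + (O + O)              ≡⟨ four-times O ⟩
  (1ℚ + 1ℚ + 1ℚ + 1ℚ) * O        ∎
  where
  open ≤-Reasoning
  O = f OPT
  four-times : ∀ o → (o + o) + (o + o) ≡ (1ℚ + 1ℚ + 1ℚ + 1ℚ) * o
  four-times = solve 1 (λ o → (o :+ o) :+ (o :+ o) := (con 1ℚ :+ con 1ℚ :+ con 1ℚ :+ con 1ℚ) :* o) refl
  c≥0 : ∀ u → 0ℚ ≤ c u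
  c≥0 u = <⇒≤ (positive⁻¹ (c u) {{cpos u}})
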